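{- Let $\varepsilon>0$ and let $G$ be an $n$-vertex graph with a fixed order $\prec$ on $V(G)$ such that $\mathrm{itm}(G)<(1-\varepsilon)n/3$. Then for every $x,y\in[0,1]$, $$\log\left|\{I: t(I)<xn,\ r(I)<yn\}\right|\le\left((1-\varepsilon)\tfrac13\log 3+x+y/2+o(1)\right)n,$$ where $I$ ranges over maximal independent sets of $G$ and $o(1)$ denotes a term tending to $0$ as $n\to\infty$.
   Context: $\log=\log_2$. An induced triangle matching of $G$ is an induced subgraph that is a vertex-disjoint union of triangles; $\mathrm{itm}(G)$ is the number of triangles in a largest one. $N(x)$ is the neighborhood of $x$ and $d_S(x)=|N(x)\cap S|$. For a maximal independent set $I$ of $G$ run the following process: set $X_0=V(G)$ and for $i=1,2,\ldots$: (1) let $x_i$ be the $\prec$-first vertex of $X_{i-1}$ among those maximizing $d_{X_{i-1}}(\cdot)$ over $X_{i-1}$; (2) if $x_i\in I$ set $X_i=X_{i-1}\setminus(\{x_i\}\cup N(x_i))$, otherwise set $X_i=X_{i-1}\setminus\{x_i\}$; (3) terminate if $d_{X_i}(x)\le 2$ for all $x\in X_i$. $t(I)$ is the number of steps $t$ performed, $X^*=X_t$, $G^*=G[X^*]$. Let $V(T)$ be the union of the vertex sets of all triangles of $G^*$, $R(I)=G^*[X^*\setminus V(T)]$ and $r(I)=|V(R(I))|$.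
   Formalization: The parameters ε, x and y, and the tolerance in the $o(1)$ term, are rational. -}

module Defs where

open import Data.Bool using (Bool; true; false; _∧_; _∨_; not; if_then_else_; T)
open import Data.Nat using (ℕ; zero; suc; _+_; _*_; _<ᵇ_; _≤ᵇ_; _/_; _⊔_; _≡ᵇ_)
open import Data.Fin using (Fin; _≟_)
open import Data.Vec using (Vec; []; _∷_; lookup)
open import Data.List using (List; []; _∷_; length; filterᵇ; allFin; foldl; foldr; map; _++_)
open import Data.Bool.ListAction using (all; any)
open import Data.Maybe using (Maybe; just; nothing)
open import Data.Product using (_×_; _,_; proj₁; proj₂)
open import Relation.Nullary.Decidable using (⌊_⌋)
open import Relation.Binary.PropositionalEquality using (_≡_)

-- A finite simple graph on the vertex set Fin n.  The fixed vertex order ≺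
-- is the natural order of Fin n.
record Graph (n : ℕ) : Set where
  field
    adj    : Fin n → Fin n → Bool
    sym    : ∀ u v → adj u v ≡ adj v u
    irrefl : ∀ v → adj v v ≡ false
open Graph public

VSet : ℕ → Set
VSet n = Fin n → Bool

_==_ : ∀ {n} → Fin n → Fin n → Bool
u == v = ⌊ u ≟ v ⌋

countᶠ : ∀ {n} → (Fin n → Bool) → ℕ
countᶠ {n} p = length (filterᵇ p (allFin n))

allSubsets : (n : ℕ) → List (Vec Bool n)
allSubsets zero    = [] ∷ []
allSubsets (suc n) = map (true ∷_) (allSubsets n) ++ map (false ∷_) (allSubsets n)

mem : ∀ {n} → Vec Bool n → VSet n
mem S v = lookup S v

deg : ∀ {n} → Graph n → VSet n → Fin n → ℕ
deg G S x = countᶠ (λ u → S u ∧ adj G x u)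

-- G[S] is a vertex-disjoint union of triangles: every vertex of S has
-- exactly two neighbours in S, and any two distinct S-neighbours of a
-- vertex of S are adjacent.
isITM : ∀ {n} → Graph n → Vec Bool n → Bool
isITM {n} G S =
  all (λ v → not (mem S v) ∨
        ((deg G (mem S) v ≡ᵇ 2) ∧
         all (λ u → all (λ w →
              not (mem S u ∧ mem S w ∧ adj G v u ∧ adj G v w ∧ not (u == w))
              ∨ adj G u w) (allFin n)) (allFin n)))
      (allFin n)

size : ∀ {n} → Vec Bool n → ℕ
size S = countᶠ (mem S)

-- itm(G): the number of triangles (= |S|/3) of a largest induced triangle matching
itm : ∀ {n} → Graph n → ℕ
itm {n} G = foldr _⊔_ 0 (map (λ S → size S / 3) (filterᵇ (isITM G) (allSubsets n)))

isIndependent : ∀ {n} → Graph n → Vec Bool n → Bool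
isIndependent {n} G I =
  all (λ u → all (λ v → not (mem I u ∧ mem I v ∧ adj G u v)) (allFin n)) (allFin n)

isMaximalIndependent : ∀ {n} → Graph n → Vec Bool n → Bool
isMaximalIndependent {n} G I =
  isIndependent G I ∧
  all (λ v → mem I v ∨ any (λ u → mem I u ∧ adj G u v) (allFin n)) (allFin n)

-- ≺-first vertex of X maximising f over X (nothing iff X is empty)
firstMax : ∀ {n} → (Fin n → ℕ) → VSet n → Maybe (Fin n)
firstMax {n} f X = foldl step nothing (allFin n)
  where
  step : Maybe (Fin n) → Fin n → Maybe (Fin n)
  step nothing  v = if X v then just v else nothing
  step (just b) v = if X v ∧ (f b <ᵇ f v) then just v else just b

nextX : ∀ {n} → Graph n → Vec Bool n → VSet n → Fin n → VSet n
nextX G I X x v =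
  X v ∧ not (v == x) ∧ (if mem I x then not (adj G x v) else true)

stopped : ∀ {n} → Graph n → VSet n → Bool
stopped {n} G X = all (λ v → not (X v) ∨ (deg G X v ≤ᵇ 2)) (allFin n)

-- run with fuel; returns (number of steps performed, current X).
-- Each step removes at least one vertex, so fuel n always suffices.
run : ∀ {n} → Graph n → Vec Bool n → ℕ → ℕ → VSet n → ℕ × VSet n
run G I zero    t X = t , X
run G I (suc k) t X with firstMax (deg G X) X
... | nothing = t , X
... | just x  = if stopped G (nextX G I X x)
                  then (suc t , nextX G I X x)
                  else run G I k (suc t) (nextX G I X x)

process : ∀ {n} → Graph n → Vec Bool n → ℕ × VSet n
process {n} G I = run G I n 0 (λ _ → true)

tI : ∀ {n} → Graph n → Vec Bool n → ℕ
tI G I = proj₁ (process G I)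

Xstar : ∀ {n} → Graph n → Vec Bool n → VSet n
Xstar G I = proj₂ (process G I)

inTriangle : ∀ {n} → Graph n → VSet n → Fin n → Bool
inTriangle {n} G X v =
  X v ∧ any (λ u → any (λ w → X u ∧ X w ∧ adj G v u ∧ adj G v w ∧ adj G u w)
                       (allFin n)) (allFin n)

rI : ∀ {n} → Graph n → Vec Bool n → ℕ
rI G I = countᶠ (λ v → Xstar G I v ∧ not (inTriangle G (Xstar G I) v))

-- |{ I maximal independent : q·t(I) < a·n , q·r(I) < b·n }|
-- (i.e. t(I) < x n and r(I) < y n with x = a/q, y = b/q)
countMIS : ∀ {n} → Graph n → (q a b : ℕ) → ℕ
countMIS {n} G q a b =
  length (filterᵇ (λ I → isMaximalIndependent G I ∧
                         (q * tI G I <ᵇ a * n) ∧ (q * rI G I <ᵇ b * n))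
                  (allSubsets n))

{-# OPTIONS --safe #-}
module Submission where

-- Every maximal independent set I is determined by the t(I) binary decisions
-- "x_i ∈ I?" taken by the process together with I ∩ X*, which is a maximal
-- independent set of G* = G[X*]. So the count is at most 2^(xn) times the
-- largest number of maximal independent sets of a graph G* of maximum degree 2
-- with r(I) < yn. In such a graph every triangle is a whole component, so the
-- triangles contribute a factor 3 each and there are at most itm(G) of them,
-- while branching on a vertex and its neighbours shows that the triangle-free
-- rest on r vertices has at most misBound r ≈ 2^(r/2) maximal independent sets.

open import Defs hiding (sym)
open import Data.Bool using (Bool; true; false; T; _∧_; _∨_; not; if_then_else_)
open import Data.Bool.ListAction using (all; any)
open import Data.Bool.Properties using (T-∧; T-∨; T-≡; T-not-≡; if-cong) renaming (_≟_ to _≟ᵇ_)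
open import Data.Empty using (⊥-elim)
open import Data.Fin using (Fin; _≟_)
open import Data.Fin.Properties using (all?; any?)
open import Data.List using (List; []; _∷_; [_]; length; filter; map; _++_; allFin; foldr; foldl)
open import Data.List.Membership.Propositional using (_∈_; lose; find)
open import Data.List.Membership.Propositional.Properties
  using (∈-filter⁺; ∈-filter⁻; ∈-∃++; ∈-++⁺ˡ; ∈-++⁺ʳ; ∈-++⁻; ∈-map⁺; ∈-map⁻; ∈-allFin)
open import Data.List.Properties using (length-++; foldl-cong; filter-none; length-filter; length-tabulate)
open import Data.List.Relation.Unary.All as All using (All; []; _∷_)
open import Data.List.Relation.Unary.All.Properties using (all⁺; all⁻; ¬All⇒Any¬)
open import Data.List.Relation.Unary.Any as Any using (Any; here; there)
open import Data.List.Relation.Unary.Any.Properties using (any⁺; any⁻)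
open import Data.List.Relation.Unary.Unique.Propositional using (Unique; []; _∷_)
import Data.List.Relation.Unary.Unique.Propositional.Properties as Unique
open import Data.Maybe using (Maybe; just; nothing; Is-just)
import Data.Maybe.Relation.Unary.Any as Maybe
open import Data.Nat
  using (ℕ; NonZero; >-nonZero; zero; suc; _+_; _*_; _^_; _∸_; _⊔_; _<ᵇ_; _≤?_; _<?_; _≤_; _<_;
         _≤′_; ≤′-refl; ≤′-step; z≤n; s≤s)
open import Data.Nat.DivMod using (_/_; /-monoˡ-≤; +-distrib-/-∣ˡ; m*n/n≡m; m/n*n≤m)
open import Data.Nat.Divisibility using (∣-refl)
open import Data.Nat.Properties hiding (_≟_)
open import Data.Nat.Tactic.RingSolver using (solve-∀)
open import Data.Product using (∃; ∃₂; _×_; _,_; proj₁; proj₂)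
open import Data.Sum using (_⊎_; inj₁; inj₂)
open import Data.Unit using (tt)
open import Data.Vec using (Vec; []; _∷_; tabulate)
import Data.Vec.Properties as Vec
open import Function.Base using (_∘_; case_of_)
open import Function.Bundles using (Equivalence)
open import Level using (0ℓ)
open import Relation.Binary.PropositionalEquality hiding ([_])
open import Relation.Nullary using (¬_; Dec; yes; no; does)
open import Relation.Nullary.Decidable
  using (⌊_⌋; T?; ¬?; _×-dec_; _⊎-dec_; _→-dec_; map′; toWitness; fromWitness; toWitnessFalse; decidable-stable)
open import Relation.Unary using (Pred; Decidable; _⊆_; _∩_; ∁)
open import Relation.Unary.Properties using (_∩?_; ∁?)

open Equivalence using (to; from)

T-not⁻ : ∀ {b} → T (not b) → ¬ T b
T-not⁻ {false} _ ()

T-not⁺ : ∀ {b} → ¬ T b → T (not b)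
T-not⁺ {false} _  = tt
T-not⁺ {true}  ¬T = ¬T tt

T-ext : ∀ {a b} → (T a → T b) → (T b → T a) → a ≡ b
T-ext {false} {false} _ _ = refl
T-ext {false} {true}  _ b⇒a = ⊥-elim (b⇒a tt)
T-ext {true}  {false} a⇒b _ = ⊥-elim (a⇒b tt)
T-ext {true}  {true}  _ _ = refl

==-refl : ∀ {n} (v : Fin n) → (v == v) ≡ true
==-refl v = to T-≡ (fromWitness {a? = v ≟ v} refl)

==-≢ : ∀ {n} {u v : Fin n} → u ≢ v → (u == v) ≡ false
==-≢ u≢v = to T-not-≡ (T-not⁺ (u≢v ∘ toWitness))

T-if-then : ∀ b {p} → (T b → T p) → T (if b then p else true)
T-if-then false _ = tt
T-if-then true  h = h tt

if-true : ∀ {A : Set} {b} {x y : A} → T b → (if b then x else y) ≡ x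
if-true Tb = if-cong (to T-≡ Tb)

if-false : ∀ {A : Set} {b} {x y : A} → ¬ T b → (if b then x else y) ≡ y
if-false ¬Tb = if-cong (to T-not-≡ (T-not⁺ ¬Tb))

injectiveOn⇒length≤ : {A B : Set} (f : A → B) {xs : List A} {ys : List B} → Unique xs →
  (∀ {x y} → x ∈ xs → y ∈ xs → f x ≡ f y → x ≡ y) → (∀ {x} → x ∈ xs → f x ∈ ys) →
  length xs ≤ length ys
injectiveOn⇒length≤ f [] _ _ = z≤n
injectiveOn⇒length≤ f {x ∷ xs} (x∉xs ∷ xs!) inj into with ∈-∃++ (into (here refl))
... | ys₁ , ys₂ , refl = begin
  suc (length xs)           ≤⟨ s≤s (injectiveOn⇒length≤ f xs! (λ p q → inj (there p) (there q)) into′) ⟩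
  suc (length (ys₁ ++ ys₂)) ≡⟨ cong suc (length-++ ys₁) ⟩
  suc (length ys₁ + length ys₂) ≡⟨ +-suc (length ys₁) (length ys₂) ⟨
  length ys₁ + length (f x ∷ ys₂) ≡⟨ length-++ ys₁ ⟨
  length (ys₁ ++ f x ∷ ys₂) ∎
  where
  open ≤-Reasoning
  into′ : ∀ {z} → z ∈ xs → f z ∈ ys₁ ++ ys₂
  into′ {z} z∈xs with ∈-++⁻ ys₁ (into (there z∈xs))
  ... | inj₁ fz∈ys₁         = ∈-++⁺ˡ fz∈ys₁
  ... | inj₂ (here fz≡fx)   = ⊥-elim (All.lookup x∉xs z∈xs (sym (inj (there z∈xs) (here refl) fz≡fx)))
  ... | inj₂ (there fz∈ys₂) = ∈-++⁺ʳ ys₁ fz∈ys₂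

foldl-preserves : ∀ {A B : Set} (P : B → Set) {f : B → A → B} →
  (∀ {b} a → P b → P (f b a)) → ∀ {b} xs → P b → P (foldl f b xs)
foldl-preserves P pres []       Pb = Pb
foldl-preserves P pres (a ∷ as) Pb = foldl-preserves P pres as (pres a Pb)

foldl-establishes : ∀ {A B : Set} (P : B → Set) {f : B → A → B} →
  (∀ {b} a → P b → P (f b a)) → ∀ {a₀} → (∀ b → P (f b a₀)) → ∀ {b xs} → a₀ ∈ xs → P (foldl f b xs)
foldl-establishes P pres est {xs = _ ∷ as} (here refl) = foldl-preserves P pres as (est _)
foldl-establishes P pres est {xs = _ ∷ _}  (there a₀∈) = foldl-establishes P pres est a₀∈

≤-foldr-⊔ : ∀ {x xs} → x ∈ xs → x ≤ foldr _⊔_ 0 xs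
≤-foldr-⊔ {xs = y ∷ ys} (here refl) = m≤m⊔n y _
≤-foldr-⊔ {xs = y ∷ ys} (there x∈) = ≤-trans (≤-foldr-⊔ x∈) (m≤n⊔m y _)

record Enumeration (A : Set) : Set where
  field
    univ  : List A
    univ! : Unique univ
    ∈univ : ∀ x → x ∈ univ

open Enumeration {{...}}

count : {A : Set} {{_ : Enumeration A}} {P : Pred A 0ℓ} → Decidable P → ℕ
count P? = length (filter P? univ)

-- Fixing A lets Agda resolve the enumeration before count unfolds, so that
-- the lemmas below unify with concrete counts.
module Counting (A : Set) {{_ : Enumeration A}} where

  private
    ∈filter⇒ : {P : Pred A 0ℓ} (P? : Decidable P) {x : A} → x ∈ filter P? univ → P x
    ∈filter⇒ P? x∈ = proj₂ (∈-filter⁻ P? {xs = univ} x∈)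

  module _ {P Q : Pred A 0ℓ} {P? : Decidable P} {Q? : Decidable Q} where

    count-injective : (f : A → A) → (∀ {x} → P x → Q (f x)) →
      (∀ {x y} → P x → P y → f x ≡ f y → x ≡ y) → count P? ≤ count Q?
    count-injective f PQ inj =
      injectiveOn⇒length≤ f (Unique.filter⁺ P? univ!)
        (λ x∈ y∈ → inj (∈filter⇒ P? x∈) (∈filter⇒ P? y∈))
        (λ x∈ → ∈-filter⁺ Q? (∈univ _) (PQ (∈filter⇒ P? x∈)))

    count-mono : P ⊆ Q → count P? ≤ count Q?
    count-mono P⊆Q = count-injective (λ x → x) P⊆Q (λ _ _ x≡y → x≡y)

    length+count≤count : P ⊆ Q → {as : List A} → Unique as → All (Q ∩ ∁ P) as →
      length as + count P? ≤ count Q?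
    length+count≤count P⊆Q {as} as! as∈Q∖P = begin
      length as + count P?            ≡⟨ length-++ as ⟨
      length (as ++ filter P? univ)   ≤⟨ injectiveOn⇒length≤ (λ x → x) as++P! (λ _ _ x≡y → x≡y) into ⟩
      count Q?                        ∎
      where
      open ≤-Reasoning
      as++P! : Unique (as ++ filter P? univ)
      as++P! = Unique.++⁺ as! (Unique.filter⁺ P? univ!)
        (λ (a∈as , a∈P) → proj₂ (All.lookup as∈Q∖P a∈as) (∈filter⇒ P? a∈P))
      into : ∀ {x} → x ∈ as ++ filter P? univ → x ∈ filter Q? univ
      into {x} x∈ with ∈-++⁻ as x∈
      ... | inj₁ x∈as = ∈-filter⁺ Q? (∈univ x) (proj₁ (All.lookup as∈Q∖P x∈as))
      ... | inj₂ x∈P  = ∈-filter⁺ Q? (∈univ x) (P⊆Q (∈filter⇒ P? x∈P))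

  module _ {P : Pred A 0ℓ} {P? : Decidable P} where

    length≤count : {as : List A} → Unique as → All P as → length as ≤ count P?
    length≤count as! as∈P = injectiveOn⇒length≤ (λ x → x) as! (λ _ _ x≡y → x≡y)
      (λ x∈as → ∈-filter⁺ P? (∈univ _) (All.lookup as∈P x∈as))

    count≤1 : (∀ {x y} → P x → P y → x ≡ y) → count P? ≤ 1
    count≤1 unique = injectiveOn⇒length≤ (λ _ → tt) {ys = tt ∷ []} (Unique.filter⁺ P? univ!)
      (λ x∈ y∈ _ → unique (∈filter⇒ P? x∈) (∈filter⇒ P? y∈))
      (λ _ → here refl)

    count≡0 : (∀ x → ¬ P x) → count P? ≡ 0
    count≡0 ∄P = cong length (filter-none P? {xs = univ} (All.tabulate λ {x} _ → ∄P x))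

    count-split : {R : Pred A 0ℓ} (R? : Decidable R) →
      count P? ≤ count (P? ∩? R?) + count (P? ∩? ∁? R?)
    count-split R? = go univ
      where
      _#_ : {S : Pred A 0ℓ} → Decidable S → List A → ℕ
      S? # xs = length (filter S? xs)
      go : ∀ xs → P? # xs ≤ (P? ∩? R?) # xs + (P? ∩? ∁? R?) # xs
      go [] = z≤n
      go (x ∷ xs) with does (P? x) | does (R? x)
      ... | true  | true  = s≤s (go xs)
      ... | true  | false = subst (suc (P? # xs) ≤_)
                                  (sym (+-suc ((P? ∩? R?) # xs) ((P? ∩? ∁? R?) # xs))) (s≤s (go xs))
      ... | false | _     = go xs

allSubsets! : ∀ n → Unique (allSubsets n)
allSubsets! zero    = [] ∷ []
allSubsets! (suc n) = Unique.++⁺ (Unique.map⁺ Vec.∷-injectiveʳ (allSubsets! n))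
  (Unique.map⁺ Vec.∷-injectiveʳ (allSubsets! n)) true≢false
  where
  true≢false : ∀ {v} → ¬ (v ∈ map (true ∷_) (allSubsets n) × v ∈ map (false ∷_) (allSubsets n))
  true≢false (v∈₁ , v∈₂) with ∈-map⁻ (true ∷_) v∈₁ | ∈-map⁻ (false ∷_) v∈₂
  ... | _ , _ , refl | _ , _ , ()

∈-allSubsets : ∀ {n} (v : Vec Bool n) → v ∈ allSubsets n
∈-allSubsets []          = here refl
∈-allSubsets (true ∷ v)  = ∈-++⁺ˡ (∈-map⁺ (true ∷_) (∈-allSubsets v))
∈-allSubsets (false ∷ v) = ∈-++⁺ʳ (map (true ∷_) (allSubsets _)) (∈-map⁺ (false ∷_) (∈-allSubsets v))

-- With this instance countᶠ p, and hence deg, size and rI, is count (T? ∘ p).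
instance
  vertices : ∀ {n} → Enumeration (Fin n)
  vertices = record { univ = allFin _ ; univ! = Unique.tabulate⁺ (λ i≡j → i≡j) ; ∈univ = ∈-allFin }

  vertexSets : ∀ {n} → Enumeration (Vec Bool n)
  vertexSets = record { univ = allSubsets _ ; univ! = allSubsets! _ ; ∈univ = ∈-allSubsets }

module _ {n : ℕ} {p : Fin n → Bool} where

  all-allFin⁻ : T (all p (allFin n)) → ∀ v → T (p v)
  all-allFin⁻ h v = All.lookup (all⁺ p (allFin n) h) (∈-allFin v)

  all-allFin⁺ : (∀ v → T (p v)) → T (all p (allFin n))
  all-allFin⁺ h = all⁻ p {xs = allFin n} (All.tabulate (λ {v} _ → h v))

  any-allFin⁻ : T (any p (allFin n)) → ∃ λ v → T (p v)
  any-allFin⁻ h = Any.satisfied (any⁻ p (allFin n) h)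

  any-allFin⁺ : ∀ v → T (p v) → T (any p (allFin n))
  any-allFin⁺ v h = any⁺ p (lose (∈-allFin v) h)

∣_∣ : ∀ {n} → VSet n → ℕ
∣ X ∣ = countᶠ X

_⊆ᵥ_ : ∀ {n} → VSet n → VSet n → Set
X ⊆ᵥ Y = ∀ {v} → T (X v) → T (Y v)

mem-ext : ∀ {n} {J J′ : Vec Bool n} → (∀ p → mem J p ≡ mem J′ p) → J ≡ J′
mem-ext {J = J} {J′} pointwise = begin
  J                 ≡⟨ Vec.tabulate∘lookup J ⟨
  tabulate (mem J)  ≡⟨ Vec.tabulate-cong pointwise ⟩
  tabulate (mem J′) ≡⟨ Vec.tabulate∘lookup J′ ⟩
  J′                ∎
  where open ≡-Reasoning

module Neighbourhoods {n : ℕ} (G : Graph n) where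
  private module Vertices = Counting (Fin n)

  Adj : Fin n → Fin n → Set
  Adj u v = T (adj G u v)

  adj-sym : ∀ {u v} → Adj u v → Adj v u
  adj-sym {u} {v} = subst T (Graph.sym G u v)

  adj⇒≢ : ∀ {u v} → Adj u v → u ≢ v
  adj⇒≢ {u} u∼u refl = subst T (irrefl G u) u∼u

  record Nbr (Y : VSet n) (v u : Fin n) : Set where
    constructor nbr
    field
      ∈Y  : T (Y u)
      adj : Adj v u

  Nbr? : ∀ Y v u → Dec (Nbr Y v u)
  Nbr? Y v u = map′ (λ (Yu , v∼u) → nbr Yu v∼u) (λ (nbr Yu v∼u) → Yu , v∼u) (T? (Y u) ×-dec T? (adj G v u))

  Nbr⇒T : ∀ {Y v u} → Nbr Y v u → T (Y u ∧ adj G v u)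
  Nbr⇒T (nbr Yu v∼u) = from T-∧ (Yu , v∼u)

  Nbr-sym : ∀ {Y v u} → T (Y v) → Nbr Y v u → Nbr Y u v
  Nbr-sym Yv (nbr _ v∼u) = nbr Yv (adj-sym v∼u)

  MaxDeg2 : VSet n → Set
  MaxDeg2 Y = ∀ {v} → T (Y v) → deg G Y v ≤ 2

  deg-mono : ∀ {X Y} → X ⊆ᵥ Y → ∀ v → deg G X v ≤ deg G Y v
  deg-mono X⊆Y v = Vertices.count-mono λ x∼ → let (Xx , v∼x) = to T-∧ x∼ in from T-∧ (X⊆Y Xx , v∼x)

  MaxDeg2-mono : ∀ {X Y} → X ⊆ᵥ Y → MaxDeg2 Y → MaxDeg2 X
  MaxDeg2-mono X⊆Y Δ≤2 {v} Xv = ≤-trans (deg-mono X⊆Y v) (Δ≤2 (X⊆Y Xv))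

  maxDeg2-nbrs : ∀ {Y v u w s} → MaxDeg2 Y → T (Y v) → Nbr Y v u → Nbr Y v w → u ≢ w →
    Nbr Y v s → s ≡ u ⊎ s ≡ w
  maxDeg2-nbrs {u = u} {w} {s} Δ≤2 Yv u∼ w∼ u≢w s∼ with s ≟ u | s ≟ w
  ... | yes s≡u | _       = inj₁ s≡u
  ... | no _    | yes s≡w = inj₂ s≡w
  ... | no s≢u  | no s≢w  = ⊥-elim (≤⇒≯ (Δ≤2 Yv)
    (Vertices.length≤count ((u≢w ∷ (s≢u ∘ sym) ∷ []) ∷ ((s≢w ∘ sym) ∷ []) ∷ [] ∷ [])
                           (Nbr⇒T u∼ ∷ Nbr⇒T w∼ ∷ Nbr⇒T s∼ ∷ [])))

  record Triangle (Y : VSet n) (v u w : Fin n) : Set where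
    field
      Yv : T (Y v)
      Yu : T (Y u)
      Yw : T (Y w)
      v∼u : Adj v u
      v∼w : Adj v w
      u∼w : Adj u w

  module _ {Y v u w} (t : Triangle Y v u w) where
    open Triangle t

    rotate : Triangle Y u w v
    rotate = record { Yv = Yu ; Yu = Yw ; Yw = Yv ; v∼u = u∼w ; v∼w = adj-sym v∼u ; u∼w = adj-sym v∼w }

    nbr₁ : Nbr Y v u
    nbr₁ = nbr Yu v∼u

    nbr₂ : Nbr Y v w
    nbr₂ = nbr Yw v∼w

    triangle-nbrs : MaxDeg2 Y → ∀ {s} → Nbr Y v s → s ≡ u ⊎ s ≡ w
    triangle-nbrs Δ≤2 = maxDeg2-nbrs Δ≤2 Yv nbr₁ nbr₂ (adj⇒≢ u∼w)

    inTriangle⁺ : T (inTriangle G Y v)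
    inTriangle⁺ = from T-∧ (Yv , any-allFin⁺ u (any-allFin⁺ w
      (from T-∧ (Yu , from T-∧ (Yw , from T-∧ (v∼u , from T-∧ (v∼w , u∼w)))))))

  inTriangle⁻ : ∀ {Y v} → T (inTriangle G Y v) → ∃₂ λ u w → Triangle Y v u w
  inTriangle⁻ h with to T-∧ h
  ... | Yv , ∃u with any-allFin⁻ ∃u
  ... | u , ∃w with any-allFin⁻ ∃w
  ... | w , t with to T-∧ t
  ... | Yu , t with to T-∧ t
  ... | Yw , t with to T-∧ t
  ... | v∼u , t with to T-∧ t
  ... | v∼w , u∼w = u , w , record { Yv = Yv ; Yu = Yu ; Yw = Yw ; v∼u = v∼u ; v∼w = v∼w ; u∼w = u∼w }

  inTriangle-mono : ∀ {X Y} → X ⊆ᵥ Y → ∀ {v} → T (inTriangle G X v) → T (inTriangle G Y v)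
  inTriangle-mono X⊆Y h with inTriangle⁻ h
  ... | u , w , t = inTriangle⁺ record
    { Yv = X⊆Y Yv ; Yu = X⊆Y Yu ; Yw = X⊆Y Yw ; v∼u = v∼u ; v∼w = v∼w ; u∼w = u∼w }
    where open Triangle t

module MaximalIndependentSets {n : ℕ} (G : Graph n) where
  open Neighbourhoods G
  open Counting (Vec Bool n)

  record IsMIS (Y : VSet n) (J : Vec Bool n) : Set where
    field
      ⊆Y          : ∀ v → T (mem J v) → T (Y v)
      independent : ∀ u v → T (mem J u) → T (mem J v) → ¬ Adj u v
      dominating  : ∀ v → T (Y v) → ¬ T (mem J v) → ∃ λ u → T (mem J u) × Adj u v
  open IsMIS public

  isMIS? : ∀ Y → Decidable (IsMIS Y)
  isMIS? Y J = map′
    (λ (⊆Y , ind , dom) → record { ⊆Y = ⊆Y ; independent = ind ; dominating = dom })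
    (λ m → ⊆Y m , independent m , dominating m)
    (all? (λ v → T? (mem J v) →-dec T? (Y v)) ×-dec
     all? (λ u → all? λ v → T? (mem J u) →-dec T? (mem J v) →-dec ¬? (T? (adj G u v))) ×-dec
     all? (λ v → T? (Y v) →-dec ¬? (T? (mem J v)) →-dec any? λ u → T? (mem J u) ×-dec T? (adj G u v)))

  misCount : VSet n → ℕ
  misCount Y = count (isMIS? Y)

  maximalIndependent⇒IsMIS : ∀ {I} → T (isMaximalIndependent G I) → IsMIS (λ _ → true) I
  maximalIndependent⇒IsMIS {I} h = record
    { ⊆Y          = λ _ _ → tt
    ; independent = λ u v Iu Iv u∼v →
        T-not⁻ (all-allFin⁻ (all-allFin⁻ (proj₁ (to T-∧ h)) u) v) (from T-∧ (Iu , from T-∧ (Iv , u∼v)))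
    ; dominating  = λ v _ → dominator v
    }
    where
    dominator : ∀ v → ¬ T (mem I v) → ∃ λ u → T (mem I u) × Adj u v
    dominator v ¬Iv with to T-∨ (all-allFin⁻ (proj₂ (to T-∧ h)) v)
    ... | inj₁ Iv = ⊥-elim (¬Iv Iv)
    ... | inj₂ ∃u = let (u , Iu∧u∼v) = any-allFin⁻ ∃u in u , to T-∧ Iu∧u∼v

  _∈N[_] : Fin n → Fin n → Set
  p ∈N[ d ] = d ≡ p ⊎ Adj d p

  _∈N?[_] : ∀ p d → Dec (p ∈N[ d ])
  p ∈N?[ d ] = d ≟ p ⊎-dec T? (adj G d p)

  ∈∖N? : ∀ (Y : VSet n) (ds : List (Fin n)) p → Dec (T (Y p) × All (λ d → ¬ p ∈N[ d ]) ds)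
  ∈∖N? Y ds p = T? (Y p) ×-dec All.all? (λ d → ¬? (p ∈N?[ d ])) ds

  _∖N[_] : VSet n → List (Fin n) → VSet n
  (Y ∖N[ ds ]) p = ⌊ ∈∖N? Y ds p ⌋

  module _ (Y : VSet n) (ds : List (Fin n)) where

    ∖N⁻ : ∀ p → T ((Y ∖N[ ds ]) p) → T (Y p) × All (λ d → ¬ p ∈N[ d ]) ds
    ∖N⁻ p = toWitness {a? = ∈∖N? Y ds p}

    ∖N⁺ : ∀ p → T (Y p) → All (λ d → ¬ p ∈N[ d ]) ds → T ((Y ∖N[ ds ]) p)
    ∖N⁺ p Yp p∉N = fromWitness {a? = ∈∖N? Y ds p} (Yp , p∉N)

    ∖N⊆ : (Y ∖N[ ds ]) ⊆ᵥ Y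
    ∖N⊆ {p} = proj₁ ∘ ∖N⁻ p

    ∈N⇒∉∖N : ∀ {p d} → d ∈ ds → p ∈N[ d ] → ¬ T ((Y ∖N[ ds ]) p)
    ∈N⇒∉∖N {p} d∈ds p∈Nd Zp = All.lookup (proj₂ (∖N⁻ p Zp)) d∈ds p∈Nd

    ∉∖N⇒ : ∀ p → ¬ T ((Y ∖N[ ds ]) p) → ¬ T (Y p) ⊎ Any (p ∈N[_]) ds
    ∉∖N⇒ p ¬Zp = case T? (Y p) of λ where
      (no ¬Yp) → inj₁ ¬Yp
      (yes Yp) → inj₂ (Any.map (decidable-stable (p ∈N?[ _ ]))
                         (¬All⇒Any¬ (λ d → ¬? (p ∈N?[ d ])) ds (¬Zp ∘ ∖N⁺ p Yp)))

  restrict : VSet n → Vec Bool n → Vec Bool n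
  restrict Z J = tabulate (λ p → mem J p ∧ Z p)

  module _ (Z : VSet n) (J : Vec Bool n) (p : Fin n) where

    restrict⁻ : T (mem (restrict Z J) p) → T (mem J p) × T (Z p)
    restrict⁻ = to T-∧ ∘ subst T (Vec.lookup∘tabulate _ p)

    restrict⁺ : T (mem J p) → T (Z p) → T (mem (restrict Z J) p)
    restrict⁺ Jp Zp = subst T (sym (Vec.lookup∘tabulate _ p)) (from T-∧ (Jp , Zp))

  restrict-IsMIS : ∀ {Y Z J} → Z ⊆ᵥ Y → IsMIS Y J →
    (∀ u v → T (mem J u) → Adj u v → T (Z v) → T (Z u)) → IsMIS Z (restrict Z J)
  restrict-IsMIS {Y} {Z} {J} Z⊆Y m closed = record
    { ⊆Y          = λ v → proj₂ ∘ restrict⁻ Z J v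
    ; independent = λ u v Ju Jv → independent m u v (proj₁ (restrict⁻ Z J u Ju)) (proj₁ (restrict⁻ Z J v Jv))
    ; dominating  = dominator
    }
    where
    dominator : ∀ v → T (Z v) → ¬ T (mem (restrict Z J) v) → ∃ λ u → T (mem (restrict Z J) u) × Adj u v
    dominator v Zv ¬J′v with dominating m v (Z⊆Y Zv) (λ Jv → ¬J′v (restrict⁺ Z J v Jv Zv))
    ... | u , Ju , u∼v = u , restrict⁺ Z J u Ju (closed u v Ju u∼v Zv) , u∼v

  restrict-injective : ∀ {Z J J′} → (∀ p → ¬ T (Z p) → mem J p ≡ mem J′ p) →
    restrict Z J ≡ restrict Z J′ → J ≡ J′
  restrict-injective {Z} {J} {J′} outside eq = mem-ext λ p → case T? (Z p) of λ where
    (no ¬Zp) → outside p ¬Zp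
    (yes Zp) → T-ext
      (λ Jp → proj₁ (restrict⁻ Z J′ p (subst (λ K → T (mem K p)) eq (restrict⁺ Z J p Jp Zp))))
      (λ J′p → proj₁ (restrict⁻ Z J p (subst (λ K → T (mem K p)) (sym eq) (restrict⁺ Z J′ p J′p Zp))))

  Contains : List (Fin n) → Vec Bool n → Set
  Contains ds J = All (T ∘ mem J) ds

  contains? : ∀ ds → Decidable (Contains ds)
  contains? ds J = All.all? (T? ∘ mem J) ds

  member? : ∀ v → Decidable (λ (J : Vec Bool n) → T (mem J v))
  member? v J = T? (mem J v)

  module _ (Y : VSet n) (ds : List (Fin n)) where

    ∖N-closed : ∀ {J} → IsMIS Y J → Contains ds J →
      ∀ u v → T (mem J u) → Adj u v → T ((Y ∖N[ ds ]) v) → T ((Y ∖N[ ds ]) u)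
    ∖N-closed m Jds u v Ju u∼v Zv = ∖N⁺ Y ds u (⊆Y m u Ju) (All.zipWith (λ where
      (_  , v∉Nd) (inj₁ refl) → v∉Nd (inj₂ u∼v)
      (Jd , _)    (inj₂ d∼u)  → independent m _ u Jd Ju d∼u) (Jds , proj₂ (∖N⁻ Y ds v Zv)))

    ∖N-determined : ∀ {J J′} → IsMIS Y J → IsMIS Y J′ → Contains ds J → Contains ds J′ →
      ∀ p → ¬ T ((Y ∖N[ ds ]) p) → mem J p ≡ mem J′ p
    ∖N-determined m m′ Jds J′ds p ¬Zp with ∉∖N⇒ Y ds p ¬Zp
    ... | inj₁ ¬Yp = T-ext (⊥-elim ∘ ¬Yp ∘ ⊆Y m p) (⊥-elim ∘ ¬Yp ∘ ⊆Y m′ p)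
    ... | inj₂ p∈N with find p∈N
    ... | d , d∈ds , inj₁ refl = T-ext (λ _ → All.lookup J′ds d∈ds) (λ _ → All.lookup Jds d∈ds)
    ... | d , d∈ds , inj₂ d∼p  = T-ext
      (λ Jp → ⊥-elim (independent m d p (All.lookup Jds d∈ds) Jp d∼p))
      (λ J′p → ⊥-elim (independent m′ d p (All.lookup J′ds d∈ds) J′p d∼p))

  misCount-∖N : ∀ Y ds → count (isMIS? Y ∩? contains? ds) ≤ misCount (Y ∖N[ ds ])
  misCount-∖N Y ds = count-injective (restrict (Y ∖N[ ds ]))
    (λ (m , Jds) → restrict-IsMIS (∖N⊆ Y ds) m (∖N-closed Y ds m Jds))
    (λ (m , Jds) (m′ , J′ds) → restrict-injective (∖N-determined Y ds m m′ Jds J′ds))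

  dominator-nbr : ∀ {Y J} → IsMIS Y J → ∀ v → T (Y v) → ¬ T (mem J v) → ∃ λ u → T (mem J u) × Nbr Y v u
  dominator-nbr m v Yv ¬Jv with dominating m v Yv ¬Jv
  ... | u , Ju , u∼v = u , Ju , nbr (⊆Y m u Ju) (adj-sym u∼v)

  forced : ∀ {Y J} → MaxDeg2 Y → IsMIS Y J → ∀ v {a b} → T (Y v) → ¬ T (mem J v) →
    Nbr Y v a → Nbr Y v b → a ≢ b → ¬ T (mem J a) → T (mem J b)
  forced Δ≤2 m v Yv ¬Jv a∼ b∼ a≢b ¬Ja with dominator-nbr m v Yv ¬Jv
  ... | s , Js , s∼ with maxDeg2-nbrs Δ≤2 Yv a∼ b∼ a≢b s∼
  ... | inj₁ refl = ⊥-elim (¬Ja Js)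
  ... | inj₂ refl = Js

-- Triangle-free graphs of maximum degree 2

-- misBound (2m) = 2^(m+1) and misBound (2m+1) = 3·2^m; the ratio bound
-- misBound-ratio is what makes the three-way branching of path close up.
misBound : ℕ → ℕ
misBound 0             = 2
misBound 1             = 3
misBound (suc (suc k)) = 2 * misBound k

misBound-suc : ∀ k → misBound k ≤ misBound (suc k)
misBound-suc 0             = s≤s (s≤s z≤n)
misBound-suc 1             = s≤s (s≤s (s≤s z≤n))
misBound-suc (suc (suc k)) = *-monoʳ-≤ 2 (misBound-suc k)

misBound-mono : ∀ {a b} → a ≤ b → misBound a ≤ misBound b
misBound-mono = go ∘ ≤⇒≤′
  where
  go : ∀ {a b} → a ≤′ b → misBound a ≤ misBound b
  go ≤′-refl       = ≤-refl
  go {b = suc b} (≤′-step a≤b) = ≤-trans (go a≤b) (misBound-suc b)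

misBound-pos : ∀ k → 1 ≤ misBound k
misBound-pos k = ≤-trans (s≤s z≤n) (misBound-mono {0} {k} z≤n)

misBound-ratio : ∀ k → 2 * misBound (suc k) ≤ 3 * misBound k
misBound-ratio 0             = ≤-refl
misBound-ratio 1             = s≤s (s≤s (s≤s (s≤s (s≤s (s≤s (s≤s (s≤s z≤n)))))))
misBound-ratio (suc (suc k)) = begin
  2 * (2 * misBound (suc k)) ≤⟨ *-monoʳ-≤ 2 (misBound-ratio k) ⟩
  2 * (3 * misBound k)       ≡⟨ *-assoc 2 3 (misBound k) ⟨
  6 * misBound k             ≡⟨ *-assoc 3 2 (misBound k) ⟩
  3 * (2 * misBound k)       ∎
  where open ≤-Reasoning

misBound-two : ∀ {a b k} → 2 + a ≤ k → 2 + b ≤ k → misBound a + misBound b ≤ misBound k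
misBound-two {a} {b} {suc (suc j)} (s≤s (s≤s a≤j)) (s≤s (s≤s b≤j)) = begin
  misBound a + misBound b ≤⟨ +-mono-≤ (misBound-mono a≤j) (misBound-mono b≤j) ⟩
  misBound j + misBound j ≡⟨ cong (misBound j +_) (+-identityʳ (misBound j)) ⟨
  2 * misBound j          ∎
  where open ≤-Reasoning

misBound-three : ∀ {a b c k} → 3 + a ≤ k → 3 + b ≤ k → 4 + c ≤ k →
  misBound a + misBound b + misBound c ≤ misBound k
misBound-three {a} {b} {c} (s≤s (s≤s (s≤s a≤))) (s≤s (s≤s (s≤s b≤))) (s≤s (s≤s (s≤s (s≤s {n = j} c≤j)))) =
  begin
  misBound a + misBound b + misBound c ≤⟨ +-mono-≤ (+-mono-≤ (misBound-mono a≤) (misBound-mono b≤))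
                                                   (misBound-mono c≤j) ⟩
  x + x + y                            ≡⟨ cong (λ z → x + z + y) (+-identityʳ x) ⟨
  2 * x + y                            ≤⟨ +-monoˡ-≤ y (misBound-ratio j) ⟩
  3 * y + y                            ≡⟨ lemma y ⟩
  2 * (2 * y)                          ∎
  where
  open ≤-Reasoning
  x = misBound (suc j)
  y = misBound j
  lemma : ∀ y → 3 * y + y ≡ 2 * (2 * y)
  lemma = solve-∀

module TriangleFreeBound {n : ℕ} (G : Graph n) where
  open Neighbourhoods G
  open MaximalIndependentSets G
  open Counting (Vec Bool n)
  private module Vertices = Counting (Fin n)

  TriangleFree : VSet n → Set
  TriangleFree Y = ∀ v → ¬ T (inTriangle G Y v)

  misCount-empty : ∀ {Y} → (∀ v → ¬ T (Y v)) → misCount Y ≤ 1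
  misCount-empty empty = count≤1 λ m m′ →
    mem-ext λ p → T-ext (⊥-elim ∘ empty p ∘ ⊆Y m p) (⊥-elim ∘ empty p ∘ ⊆Y m′ p)

  module _ {Y : VSet n} (Δ≤2 : MaxDeg2 Y)
    (IH : ∀ ds → ∣ Y ∖N[ ds ] ∣ < ∣ Y ∣ → misCount (Y ∖N[ ds ]) ≤ misBound ∣ Y ∖N[ ds ] ∣)
    where

    private
      removed : ∀ ds {as} → Unique as → All (λ a → T (Y a) × ¬ T ((Y ∖N[ ds ]) a)) as →
        length as + ∣ Y ∖N[ ds ] ∣ ≤ ∣ Y ∣
      removed ds = Vertices.length+count≤count (∖N⊆ Y ds)

      containing≤ : ∀ ds {k} → suc k + ∣ Y ∖N[ ds ] ∣ ≤ ∣ Y ∣ →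
        count (isMIS? Y ∩? contains? ds) ≤ misBound ∣ Y ∖N[ ds ] ∣
      containing≤ ds {k} size = ≤-trans (misCount-∖N Y ds) (IH ds (≤-trans (s≤s (m≤n+m _ k)) size))

    isolated : ∀ {v} → T (Y v) → (∀ s → ¬ Nbr Y v s) → misCount Y ≤ misBound ∣ Y ∣
    isolated {v} Yv no-nbr = begin
      misCount Y                         ≤⟨ count-mono (λ {J} m → m , v∈ m ∷ []) ⟩
      count (isMIS? Y ∩? contains? [ v ]) ≤⟨ containing≤ [ v ] size-v ⟩
      misBound ∣ Y ∖N[ [ v ] ] ∣          ≤⟨ misBound-mono (≤-trans (m≤n+m _ 1) size-v) ⟩
      misBound ∣ Y ∣                      ∎
      where
      open ≤-Reasoning
      v∈ : ∀ {J} → IsMIS Y J → T (mem J v)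
      v∈ m = decidable-stable (T? _) λ ¬Jv →
        let (u , _ , u∼) = dominator-nbr m v Yv ¬Jv in no-nbr u u∼
      size-v : 1 + ∣ Y ∖N[ [ v ] ] ∣ ≤ ∣ Y ∣
      size-v = removed [ v ] ([] ∷ []) ((Yv , ∈N⇒∉∖N Y _ (here refl) (inj₁ refl)) ∷ [])

    pendant : ∀ {v u} → T (Y v) → Nbr Y v u → (∀ s → Nbr Y v s → s ≡ u) → misCount Y ≤ misBound ∣ Y ∣
    pendant {v} {u} Yv u∼ only-u = begin
      misCount Y                                                          ≤⟨ count-split (member? v) ⟩
      count (isMIS? Y ∩? member? v) + count (isMIS? Y ∩? ∁? (member? v))  ≤⟨ +-mono-≤
        (≤-trans (count-mono λ (m , Jv) → m , Jv ∷ []) (containing≤ [ v ] size-v))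
        (≤-trans (count-mono λ (m , ¬Jv) → m , u∈ m ¬Jv ∷ []) (containing≤ [ u ] size-u)) ⟩
      misBound ∣ Y ∖N[ [ v ] ] ∣ + misBound ∣ Y ∖N[ [ u ] ] ∣             ≤⟨ misBound-two size-v size-u ⟩
      misBound ∣ Y ∣                                                       ∎
      where
      open ≤-Reasoning
      open Nbr u∼ renaming (∈Y to Yu; adj to v∼u)
      u∈ : ∀ {J} → IsMIS Y J → ¬ T (mem J v) → T (mem J u)
      u∈ {J} m ¬Jv with dominator-nbr m v Yv ¬Jv
      ... | s , Js , s∼ = subst (T ∘ mem J) (only-u s s∼) Js
      size-v : 2 + ∣ Y ∖N[ [ v ] ] ∣ ≤ ∣ Y ∣
      size-v = removed [ v ] ((adj⇒≢ v∼u ∷ []) ∷ [] ∷ [])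
        ((Yv , ∈N⇒∉∖N Y _ (here refl) (inj₁ refl)) ∷ (Yu , ∈N⇒∉∖N Y _ (here refl) (inj₂ v∼u)) ∷ [])
      size-u : 2 + ∣ Y ∖N[ [ u ] ] ∣ ≤ ∣ Y ∣
      size-u = removed [ u ] ((adj⇒≢ (adj-sym v∼u) ∷ []) ∷ [] ∷ [])
        ((Yu , ∈N⇒∉∖N Y _ (here refl) (inj₁ refl)) ∷ (Yv , ∈N⇒∉∖N Y _ (here refl) (inj₂ (adj-sym v∼u))) ∷ [])

    path-sizes : ∀ {v u w u′} → T (Y v) → Nbr Y v u → Nbr Y v w → u ≢ w → w ≢ u′ → Nbr Y u u′ → u′ ≢ v →
      3 + ∣ Y ∖N[ [ v ] ] ∣ ≤ ∣ Y ∣ × 3 + ∣ Y ∖N[ [ u ] ] ∣ ≤ ∣ Y ∣ × 4 + ∣ Y ∖N[ w ∷ u′ ∷ [] ] ∣ ≤ ∣ Y ∣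
    path-sizes {v} {u} {w} {u′} Yv (nbr Yu v∼u) (nbr Yw v∼w) u≢w w≢u′ (nbr Yu′ u∼u′) u′≢v =
      removed [ v ] ((v≢u ∷ v≢w ∷ []) ∷ (u≢w ∷ []) ∷ [] ∷ [])
        ((Yv , out (here refl) (inj₁ refl)) ∷ (Yu , out (here refl) (inj₂ v∼u)) ∷
         (Yw , out (here refl) (inj₂ v∼w)) ∷ []) ,
      removed [ u ] ((v≢u ∘ sym ∷ u≢u′ ∷ []) ∷ (u′≢v ∘ sym ∷ []) ∷ [] ∷ [])
        ((Yu , out (here refl) (inj₁ refl)) ∷ (Yv , out (here refl) (inj₂ (adj-sym v∼u))) ∷
         (Yu′ , out (here refl) (inj₂ u∼u′)) ∷ []) ,
      removed (w ∷ u′ ∷ [])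
        ((w≢u′ ∷ v≢w ∘ sym ∷ u≢w ∘ sym ∷ []) ∷ (u′≢v ∷ u≢u′ ∘ sym ∷ []) ∷ (v≢u ∷ []) ∷ [] ∷ [])
        ((Yw , out (here refl) (inj₁ refl)) ∷ (Yu′ , out (there (here refl)) (inj₁ refl)) ∷
         (Yv , out (here refl) (inj₂ (adj-sym v∼w))) ∷ (Yu , out (there (here refl)) (inj₂ (adj-sym u∼u′))) ∷ [])
      where
      v≢u = adj⇒≢ v∼u
      v≢w = adj⇒≢ v∼w
      u≢u′ = adj⇒≢ u∼u′
      out : ∀ {ds p d} → d ∈ ds → p ∈N[ d ] → ¬ T ((Y ∖N[ ds ]) p)
      out = ∈N⇒∉∖N Y _

    -- A maximal independent set contains v, or u, or else w and u′ (forced by Δ ≤ 2).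
    path : ∀ {v u w u′} → T (Y v) → Nbr Y v u → Nbr Y v w → u ≢ w → ¬ Adj u w → Nbr Y u u′ → u′ ≢ v →
      misCount Y ≤ misBound ∣ Y ∣
    path {v} {u} {w} {u′} Yv u∼ w∼ u≢w u≁w u′∼ u′≢v = begin
      misCount Y
        ≤⟨ count-split (member? v) ⟩
      count (MIS ∩? member? v) + count (MIS ∩? ∁? (member? v))
        ≤⟨ +-monoʳ-≤ _ (count-split (member? u)) ⟩
      count (MIS ∩? member? v) + (count ((MIS ∩? ∁? (member? v)) ∩? member? u)
                                  + count ((MIS ∩? ∁? (member? v)) ∩? ∁? (member? u)))
        ≤⟨ +-mono-≤ (≤-trans (count-mono λ (m , Jv) → m , Jv ∷ []) (containing≤ [ v ] size-v))
            (+-mono-≤ (≤-trans (count-mono λ ((m , _) , Ju) → m , Ju ∷ []) (containing≤ [ u ] size-u))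
                      (≤-trans (count-mono λ ((m , ¬Jv) , ¬Ju) → m , w∧u′∈ m ¬Jv ¬Ju)
                               (containing≤ (w ∷ u′ ∷ []) size-wu′))) ⟩
      misBound ∣ Y ∖N[ [ v ] ] ∣ + (misBound ∣ Y ∖N[ [ u ] ] ∣ + misBound ∣ Y ∖N[ w ∷ u′ ∷ [] ] ∣)
        ≡⟨ +-assoc (misBound ∣ Y ∖N[ [ v ] ] ∣) _ _ ⟨
      misBound ∣ Y ∖N[ [ v ] ] ∣ + misBound ∣ Y ∖N[ [ u ] ] ∣ + misBound ∣ Y ∖N[ w ∷ u′ ∷ [] ] ∣
        ≤⟨ misBound-three size-v size-u size-wu′ ⟩
      misBound ∣ Y ∣ ∎
      where
      open ≤-Reasoning
      MIS = isMIS? Y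
      w≢u′ : w ≢ u′
      w≢u′ refl = u≁w (Nbr.adj u′∼)
      sizes = path-sizes Yv u∼ w∼ u≢w w≢u′ u′∼ u′≢v
      size-v = proj₁ sizes
      size-u = proj₁ (proj₂ sizes)
      size-wu′ = proj₂ (proj₂ sizes)
      w∧u′∈ : ∀ {J} → IsMIS Y J → ¬ T (mem J v) → ¬ T (mem J u) → Contains (w ∷ u′ ∷ []) J
      w∧u′∈ m ¬Jv ¬Ju =
        forced Δ≤2 m v Yv ¬Jv u∼ w∼ u≢w ¬Ju ∷
        forced Δ≤2 m u (Nbr.∈Y u∼) ¬Ju (Nbr-sym Yv u∼) u′∼ (u′≢v ∘ sym) ¬Jv ∷ []

    triangleFree-step : TriangleFree Y → misCount Y ≤ misBound ∣ Y ∣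
    triangleFree-step △-free with any? (T? ∘ Y)
    ... | no ∄v = ≤-trans (misCount-empty λ v Yv → ∄v (v , Yv)) (misBound-pos ∣ Y ∣)
    ... | yes (v , Yv) with any? (Nbr? Y v)
    ...   | no ∄u = isolated Yv λ s s∼ → ∄u (s , s∼)
    ...   | yes (u , u∼) with any? (λ s → Nbr? Y v s ×-dec ¬? (s ≟ u))
    ...     | no ∄w = pendant Yv u∼ λ s s∼ → decidable-stable (s ≟ u) λ s≢u → ∄w (s , s∼ , s≢u)
    ...     | yes (w , w∼ , w≢u) with any? (λ s → Nbr? Y u s ×-dec ¬? (s ≟ v))
    ...       | no ∄u′ = pendant (Nbr.∈Y u∼) (Nbr-sym Yv u∼)
                             λ s s∼ → decidable-stable (s ≟ v) λ s≢v → ∄u′ (s , s∼ , s≢v)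
    ...       | yes (u′ , u′∼ , u′≢v) = path Yv u∼ w∼ (w≢u ∘ sym) u≁w u′∼ u′≢v
      where
      u≁w : ¬ Adj u w
      u≁w u∼w = △-free v (inTriangle⁺ record
        { Yv = Yv ; Yu = Nbr.∈Y u∼ ; Yw = Nbr.∈Y w∼ ; v∼u = Nbr.adj u∼ ; v∼w = Nbr.adj w∼ ; u∼w = u∼w })

  misCount-triangleFree : ∀ k {Y} → ∣ Y ∣ < k → MaxDeg2 Y → TriangleFree Y → misCount Y ≤ misBound ∣ Y ∣
  misCount-triangleFree (suc k) {Y} |Y|≤k Δ≤2 △-free = triangleFree-step Δ≤2 IH △-free
    where
    IH : ∀ ds → ∣ Y ∖N[ ds ] ∣ < ∣ Y ∣ → misCount (Y ∖N[ ds ]) ≤ misBound ∣ Y ∖N[ ds ] ∣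
    IH ds smaller = misCount-triangleFree k (<-≤-trans smaller (≤-pred |Y|≤k))
      (MaxDeg2-mono (∖N⊆ Y ds) Δ≤2) (λ p → △-free p ∘ inTriangle-mono (∖N⊆ Y ds))

-- Graphs of maximum degree 2

≤-by-thirds : ∀ {a b c m} → 3 * a ≤ m → 3 * b ≤ m → 3 * c ≤ m → a + b + c ≤ m
≤-by-thirds {a} {b} {c} {m} 3a≤m 3b≤m 3c≤m = *-cancelˡ-≤ 3 (begin
  3 * (a + b + c)         ≡⟨ lemma a b c ⟩
  3 * a + 3 * b + 3 * c   ≤⟨ +-mono-≤ (+-mono-≤ 3a≤m 3b≤m) 3c≤m ⟩
  m + m + m               ≡⟨ lemma′ m ⟩
  3 * m                   ∎)
  where
  open ≤-Reasoning
  lemma : ∀ a b c → 3 * (a + b + c) ≡ 3 * a + 3 * b + 3 * c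
  lemma = solve-∀
  lemma′ : ∀ m → m + m + m ≡ 3 * m
  lemma′ = solve-∀

module MaxDeg2Bound {n : ℕ} (G : Graph n) where
  open Neighbourhoods G
  open MaximalIndependentSets G
  open TriangleFreeBound G
  open Counting (Vec Bool n)
  private module Vertices = Counting (Fin n)

  -- |V(T)| and r of the paper for G[X]; in particular rI G I = ∣R∣ (Xstar G I).
  ∣VT∣ : VSet n → ℕ
  ∣VT∣ X = countᶠ (inTriangle G X)

  ∣R∣ : VSet n → ℕ
  ∣R∣ X = countᶠ (λ v → X v ∧ not (inTriangle G X v))

  inTriangle⇒∈ : ∀ X v → T (inTriangle G X v) → T (X v)
  inTriangle⇒∈ X v = proj₁ ∘ to T-∧

  -- With Δ ≤ 2 a triangle is a component, so deleting N[z] deletes just the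
  -- triangle and does not change which other vertices lie on triangles.
  module _ {Y : VSet n} (Δ≤2 : MaxDeg2 Y) {z z₁ z₂ : Fin n} (t : Triangle Y z z₁ z₂) where
    open Triangle t

    triangle-closed : ∀ {s p} → T (Y s) → s ∈N[ z ] → Nbr Y s p → p ∈N[ z ]
    triangle-closed _  (inj₁ refl) s∼p = inj₂ (Nbr.adj s∼p)
    triangle-closed Ys (inj₂ z∼s)  s∼p with triangle-nbrs t Δ≤2 (nbr Ys z∼s)
    ... | inj₁ refl with triangle-nbrs (rotate t) Δ≤2 s∼p
    ...   | inj₁ refl = inj₂ v∼w
    ...   | inj₂ refl = inj₁ refl
    triangle-closed Ys (inj₂ z∼s) s∼p | inj₂ refl with triangle-nbrs (rotate (rotate t)) Δ≤2 s∼p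
    ...   | inj₁ refl = inj₁ refl
    ...   | inj₂ refl = inj₂ v∼u

    private
      Y′ = Y ∖N[ [ z ] ]

      z∉ : ∀ {p} → p ∈N[ z ] → ¬ T (Y′ p)
      z∉ = ∈N⇒∉∖N Y [ z ] (here refl)

    ∣VT∣-∖N : 3 + ∣VT∣ Y′ ≤ ∣VT∣ Y
    ∣VT∣-∖N = Vertices.length+count≤count (inTriangle-mono (∖N⊆ Y [ z ]))
      ((adj⇒≢ v∼u ∷ adj⇒≢ v∼w ∷ []) ∷ (adj⇒≢ u∼w ∷ []) ∷ [] ∷ [])
      ((inTriangle⁺ t , z∉ (inj₁ refl) ∘ inTriangle⇒∈ Y′ z) ∷
       (inTriangle⁺ (rotate t) , z∉ (inj₂ v∼u) ∘ inTriangle⇒∈ Y′ z₁) ∷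
       (inTriangle⁺ (rotate (rotate t)) , z∉ (inj₂ v∼w) ∘ inTriangle⇒∈ Y′ z₂) ∷ [])

    inTriangle-∖N : ∀ {p} → T (Y′ p) → T (inTriangle G Y p) → T (inTriangle G Y′ p)
    inTriangle-∖N {p} Y′p △ with inTriangle⁻ △
    ... | s , s′ , t′ = inTriangle⁺ record
      { Yv = Y′p ; Yu = stays (nbr₁ t′) ; Yw = stays (nbr₂ t′)
      ; v∼u = Triangle.v∼u t′ ; v∼w = Triangle.v∼w t′ ; u∼w = Triangle.u∼w t′ }
      where
      stays : ∀ {s} → Nbr Y p s → T (Y′ s)
      stays {s} s∼ = ∖N⁺ Y [ z ] s (Nbr.∈Y s∼)
        ((λ s∈N → z∉ (triangle-closed (Nbr.∈Y s∼) s∈N (Nbr-sym (∖N⊆ Y [ z ] Y′p) s∼)) Y′p) ∷ [])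

    ∣R∣-∖N : ∣R∣ Y′ ≤ ∣R∣ Y
    ∣R∣-∖N = Vertices.count-mono λ {p} h → let (Y′p , ¬△′) = to T-∧ h in
      from T-∧ (∖N⊆ Y [ z ] Y′p , T-not⁺ (T-not⁻ ¬△′ ∘ inTriangle-∖N Y′p))

  misBound△ : VSet n → ℕ
  misBound△ Y = 3 ^ (∣VT∣ Y / 3) * misBound (∣R∣ Y)

  module _ {Y : VSet n} (Δ≤2 : MaxDeg2 Y)
    (IH : ∀ ds → ∣VT∣ (Y ∖N[ ds ]) < ∣VT∣ Y → misCount (Y ∖N[ ds ]) ≤ misBound△ (Y ∖N[ ds ]))
    where

    no-triangle : (∀ v → ¬ T (inTriangle G Y v)) → misCount Y ≤ misBound△ Y
    no-triangle ∄△ = begin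
      misCount Y        ≤⟨ misCount-triangleFree (suc ∣ Y ∣) ≤-refl Δ≤2 ∄△ ⟩
      misBound ∣ Y ∣     ≤⟨ misBound-mono (Vertices.count-mono λ {p} Yp → from T-∧ (Yp , T-not⁺ (∄△ p))) ⟩
      misBound (∣R∣ Y)   ≤⟨ m≤n*m _ (3 ^ (∣VT∣ Y / 3)) {{m^n≢0 3 (∣VT∣ Y / 3)}} ⟩
      misBound△ Y        ∎
      where open ≤-Reasoning

    triangle-branch : ∀ {x x₁ x₂} → Triangle Y x x₁ x₂ → 3 * misCount (Y ∖N[ [ x ] ]) ≤ misBound△ Y
    triangle-branch {x} t = begin
      3 * misCount Y′                              ≤⟨ *-monoʳ-≤ 3 (IH [ x ] (≤-trans (s≤s (m≤n+m _ 2)) (∣VT∣-∖N Δ≤2 t))) ⟩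
      3 * (3 ^ (∣VT∣ Y′ / 3) * misBound (∣R∣ Y′))  ≡⟨ *-assoc 3 (3 ^ (∣VT∣ Y′ / 3)) (misBound (∣R∣ Y′)) ⟨
      3 ^ suc (∣VT∣ Y′ / 3) * misBound (∣R∣ Y′)    ≤⟨ *-mono-≤ (^-monoʳ-≤ 3 fewer-triangles) (misBound-mono (∣R∣-∖N Δ≤2 t)) ⟩
      misBound△ Y                                  ∎
      where
      open ≤-Reasoning
      Y′ = Y ∖N[ [ x ] ]
      fewer-triangles : suc (∣VT∣ Y′ / 3) ≤ ∣VT∣ Y / 3
      fewer-triangles = subst (_≤ ∣VT∣ Y / 3) (+-distrib-/-∣ˡ {3} (∣VT∣ Y′) {3} ∣-refl)
                              (/-monoˡ-≤ 3 (∣VT∣-∖N Δ≤2 t))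

    -- A maximal independent set contains z, or z₁, or else (by Δ ≤ 2) z₂.
    triangle : ∀ {z z₁ z₂} → Triangle Y z z₁ z₂ → misCount Y ≤ misBound△ Y
    triangle {z} {z₁} {z₂} t = begin
      misCount Y
        ≤⟨ count-split (member? z) ⟩
      count (MIS ∩? member? z) + count (MIS ∩? ∁? (member? z))
        ≤⟨ +-monoʳ-≤ _ (count-split (member? z₁)) ⟩
      count (MIS ∩? member? z) + (count ((MIS ∩? ∁? (member? z)) ∩? member? z₁)
                                  + count ((MIS ∩? ∁? (member? z)) ∩? ∁? (member? z₁)))
        ≤⟨ +-mono-≤ (≤-trans (count-mono λ (m , Jz) → m , Jz ∷ []) (misCount-∖N Y [ z ]))
            (+-mono-≤ (≤-trans (count-mono λ ((m , _) , Jz₁) → m , Jz₁ ∷ []) (misCount-∖N Y [ z₁ ]))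
                      (≤-trans (count-mono λ ((m , ¬Jz) , ¬Jz₁) → m , z₂∈ m ¬Jz ¬Jz₁ ∷ [])
                               (misCount-∖N Y [ z₂ ]))) ⟩
      misCount (Y ∖N[ [ z ] ]) + (misCount (Y ∖N[ [ z₁ ] ]) + misCount (Y ∖N[ [ z₂ ] ]))
        ≡⟨ +-assoc (misCount (Y ∖N[ [ z ] ])) _ _ ⟨
      misCount (Y ∖N[ [ z ] ]) + misCount (Y ∖N[ [ z₁ ] ]) + misCount (Y ∖N[ [ z₂ ] ])
        ≤⟨ ≤-by-thirds {misCount (Y ∖N[ [ z ] ])} {misCount (Y ∖N[ [ z₁ ] ])} {misCount (Y ∖N[ [ z₂ ] ])}
             (triangle-branch t) (triangle-branch (rotate t)) (triangle-branch (rotate (rotate t))) ⟩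
      misBound△ Y ∎
      where
      open ≤-Reasoning
      MIS = isMIS? Y
      z₂∈ : ∀ {J} → IsMIS Y J → ¬ T (mem J z) → ¬ T (mem J z₁) → T (mem J z₂)
      z₂∈ m ¬Jz ¬Jz₁ = forced Δ≤2 m z (Triangle.Yv t) ¬Jz (nbr₁ t) (nbr₂ t) (adj⇒≢ (Triangle.u∼w t)) ¬Jz₁

    maxDeg2-step : misCount Y ≤ misBound△ Y
    maxDeg2-step with any? (T? ∘ inTriangle G Y)
    ... | no ∄△        = no-triangle λ v △ → ∄△ (v , △)
    ... | yes (_ , △z) = triangle (proj₂ (proj₂ (inTriangle⁻ △z)))

  misCount-maxDeg2 : ∀ k {Y} → ∣VT∣ Y < k → MaxDeg2 Y → misCount Y ≤ misBound△ Y
  misCount-maxDeg2 (suc k) {Y} VT<k Δ≤2 = maxDeg2-step Δ≤2 IH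
    where
    IH : ∀ ds → ∣VT∣ (Y ∖N[ ds ]) < ∣VT∣ Y → misCount (Y ∖N[ ds ]) ≤ misBound△ (Y ∖N[ ds ])
    IH ds smaller = misCount-maxDeg2 k (<-≤-trans smaller (≤-pred VT<k)) (MaxDeg2-mono (∖N⊆ Y ds) Δ≤2)

module TriangleMatchings {n : ℕ} (G : Graph n) where
  open Neighbourhoods G
  open MaxDeg2Bound G using (∣VT∣)
  private module Vertices = Counting (Fin n)

  triangleVertices : VSet n → Vec Bool n
  triangleVertices X = tabulate (inTriangle G X)

  module _ {X : VSet n} (Δ≤2 : MaxDeg2 X) where
    private
      S = triangleVertices X

      S⇔ : ∀ p → mem S p ≡ inTriangle G X p
      S⇔ = Vec.lookup∘tabulate (inTriangle G X)

      S⊆X : mem S ⊆ᵥ X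
      S⊆X {p} = proj₁ ∘ to T-∧ ∘ subst T (S⇔ p)

      inS : ∀ {v u w} → Triangle X v u w → T (mem S v)
      inS {v} t = subst T (sym (S⇔ v)) (inTriangle⁺ t)

      deg≡2 : ∀ {v u w} → Triangle X v u w → deg G (mem S) v ≡ 2
      deg≡2 {v} t = ≤-antisym
        (≤-trans (deg-mono S⊆X v) (Δ≤2 (Triangle.Yv t)))
        (Vertices.length≤count ((adj⇒≢ (Triangle.u∼w t) ∷ []) ∷ [] ∷ [])
          (from T-∧ (inS (rotate t) , Triangle.v∼u t) ∷ from T-∧ (inS (rotate (rotate t)) , Triangle.v∼w t) ∷ []))

      adjacent : ∀ {v u w u′ w′} → Triangle X v u w → u′ ≡ u ⊎ u′ ≡ w → w′ ≡ u ⊎ w′ ≡ w → u′ ≢ w′ → Adj u′ w′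
      adjacent _ (inj₁ refl) (inj₁ refl) u′≢w′ = ⊥-elim (u′≢w′ refl)
      adjacent t (inj₁ refl) (inj₂ refl) _     = Triangle.u∼w t
      adjacent t (inj₂ refl) (inj₁ refl) _     = adj-sym (Triangle.u∼w t)
      adjacent _ (inj₂ refl) (inj₂ refl) u′≢w′ = ⊥-elim (u′≢w′ refl)

      only-triangle : ∀ {v u w} → Triangle X v u w → ∀ u′ w′ →
        T (not (mem S u′ ∧ mem S w′ ∧ adj G v u′ ∧ adj G v w′ ∧ not (u′ == w′)) ∨ adj G u′ w′)
      only-triangle t u′ w′ = case T? (adj G u′ w′) of λ where
        (yes u′∼w′) → from T-∨ (inj₂ u′∼w′)
        (no u′≁w′)  → from T-∨ (inj₁ (T-not⁺ λ h →
          let (Su′ , h) = to T-∧ h ; (Sw′ , h) = to T-∧ h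
              (v∼u′ , h) = to T-∧ h ; (v∼w′ , u′≢w′) = to T-∧ h
          in u′≁w′ (adjacent t (triangle-nbrs t Δ≤2 (nbr (S⊆X Su′) v∼u′))
                               (triangle-nbrs t Δ≤2 (nbr (S⊆X Sw′) v∼w′))
                              (toWitnessFalse u′≢w′))))

    triangleVertices-isITM : T (isITM G S)
    triangleVertices-isITM = all-allFin⁺ λ v → case T? (mem S v) of λ where
      (no ¬Sv) → from T-∨ (inj₁ (T-not⁺ ¬Sv))
      (yes Sv) → let (u , w , t) = inTriangle⁻ (subst T (S⇔ v) Sv) in
        from T-∨ (inj₂ (from T-∧ (≡⇒≡ᵇ _ 2 (deg≡2 t) ,
                                  all-allFin⁺ λ u′ → all-allFin⁺ λ w′ → only-triangle t u′ w′)))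

    ∣VT∣/3≤itm : ∣VT∣ X / 3 ≤ itm G
    ∣VT∣/3≤itm = ≤-trans (/-monoˡ-≤ 3 (Vertices.count-mono λ {p} → subst T (sym (S⇔ p))))
      (≤-foldr-⊔ (∈-map⁺ (λ S → size S / 3)
                          (∈-filter⁺ (T? ∘ isITM G) (∈-allSubsets S) triangleVertices-isITM)))

-- The process

module FirstMax {n : ℕ} (f : Fin n → ℕ) (X : VSet n) where

  -- a copy of the where-bound step function of Defs.firstMax, which is not nameable here
  step : Maybe (Fin n) → Fin n → Maybe (Fin n)
  step nothing  v = if X v then just v else nothing
  step (just b) v = if X v ∧ (f b <ᵇ f v) then just v else just b

  firstMax≡foldl : firstMax f X ≡ foldl step nothing (allFin n)
  firstMax≡foldl = foldl-cong (λ where nothing _ → refl ; (just _) _ → refl) nothing (allFin n)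

  private
    InX : Maybe (Fin n) → Set
    InX m = ∀ {x} → m ≡ just x → T (X x)

    step-InX : ∀ {m} v → InX m → InX (step m v)
    step-InX {nothing} v _ with X v in Xv
    ... | true  = λ { refl → subst T (sym Xv) tt }
    ... | false = λ ()
    step-InX {just b} v inX with X v ∧ (f b <ᵇ f v) in cond
    ... | true  = λ { refl → proj₁ (to T-∧ (subst T (sym cond) tt)) }
    ... | false = inX

    step-just : ∀ {m} v → Is-just m → Is-just (step m v)
    step-just {just b} v _ with X v ∧ (f b <ᵇ f v)
    ... | true  = Maybe.just tt
    ... | false = Maybe.just tt

    step-∈X : ∀ {v} → T (X v) → ∀ m → Is-just (step m v)
    step-∈X {v} Xv nothing  rewrite to T-≡ Xv = Maybe.just tt
    step-∈X {v} Xv (just b) with X v ∧ (f b <ᵇ f v)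
    ... | true  = Maybe.just tt
    ... | false = Maybe.just tt

  firstMax-just : ∀ {x} → firstMax f X ≡ just x → T (X x)
  firstMax-just eq = foldl-preserves InX step-InX (allFin n) (λ ()) (trans (sym firstMax≡foldl) eq)

  firstMax-nothing : firstMax f X ≡ nothing → ∀ v → ¬ T (X v)
  firstMax-nothing eq v Xv
    with subst Is-just (trans (sym firstMax≡foldl) eq)
           (foldl-establishes Is-just step-just (step-∈X Xv) (∈-allFin v))
  ... | ()

module Process {n : ℕ} (G : Graph n) where
  open Neighbourhoods G
  open MaximalIndependentSets G
  open Counting (Vec Bool n)
  private module Vertices = Counting (Fin n)

  -- The runs form a binary tree of decisions "x ∈ I?". Along a branch, J₀ holds
  -- the decided values of I on the vertices that have left X (Agrees), and no
  -- vertex of J₀ has a neighbour still in X (Consistent). X-after X x (mem I x)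
  -- is definitionally nextX G I X x.
  X-after : VSet n → Fin n → Bool → VSet n
  X-after X x c v = X v ∧ not (v == x) ∧ (if c then not (adj G x v) else true)

  J₀-after : VSet n → VSet n → Fin n → Bool → VSet n
  J₀-after X J₀ x c v = if X v then (v == x) ∧ c else J₀ v

  Consistent : VSet n → VSet n → Set
  Consistent X J₀ = ∀ v u → ¬ T (X v) → T (J₀ v) → Adj v u → ¬ T (X u)

  Agrees : VSet n → VSet n → Vec Bool n → Set
  Agrees J₀ X I = ∀ v → ¬ T (X v) → mem I v ≡ J₀ v

  agrees? : ∀ J₀ X → Decidable (Agrees J₀ X)
  agrees? J₀ X I = all? λ v → ¬? (T? (X v)) →-dec (mem I v ≟ᵇ J₀ v)

  module _ (X : VSet n) (x : Fin n) (c : Bool) where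

    X-after⁻ : ∀ v → T (X-after X x c v) → T (X v) × v ≢ x × (T c → ¬ Adj x v)
    X-after⁻ v h with to T-∧ h
    ... | Xv , h′ with to T-∧ h′
    ... | v≢x , adj-ok = Xv , toWitnessFalse v≢x , λ Tc → T-not⁻ (subst T (if-true Tc) adj-ok)

    X-after⊆ : X-after X x c ⊆ᵥ X
    X-after⊆ {v} = proj₁ ∘ X-after⁻ v

    X-after-shrinks : T (X x) → ∣ X-after X x c ∣ < ∣ X ∣
    X-after-shrinks Xx = Vertices.length+count≤count X-after⊆ ([] ∷ [])
      ((Xx , λ h → proj₁ (proj₂ (X-after⁻ x h)) refl) ∷ [])

    X-after⁺ : ∀ v → T (X v) → v ≢ x → (T c → ¬ Adj x v) → T (X-after X x c v)
    X-after⁺ v Xv v≢x ok = from T-∧ (Xv , from T-∧ (T-not⁺ (v≢x ∘ toWitness) , T-if-then c (T-not⁺ ∘ ok)))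

    X-after-left : ∀ v → T (X v) → v ≢ x → ¬ T (X-after X x c v) → T c × Adj x v
    X-after-left v Xv v≢x ¬X′v = decidable-stable (T? c ×-dec T? (adj G x v))
      λ ¬left → ¬X′v (X-after⁺ v Xv v≢x λ Tc x∼v → ¬left (Tc , x∼v))

    Consistent-after : ∀ {J₀} → Consistent X J₀ → Consistent (X-after X x c) (J₀-after X J₀ x c)
    Consistent-after cons v u ¬X′v J₀′v v∼u X′u = case T? (X v) of λ where
      (no ¬Xv) → cons v u ¬Xv (subst T (if-false ¬Xv) J₀′v) v∼u (X-after⊆ X′u)
      (yes Xv) → let (v≡x , Tc) = to T-∧ (subst T (if-true Xv) J₀′v) in
        proj₂ (proj₂ (X-after⁻ u X′u)) Tc (subst (λ w → Adj w u) (toWitness v≡x) v∼u)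

    private
      leaving : ∀ {I} → IsMIS (λ _ → true) I → mem I x ≡ c → ∀ v → T (X v) → ¬ T (X-after X x c v) →
        mem I v ≡ (v == x) ∧ c
      leaving {I} m Ix≡c v Xv ¬X′v = case v ≟ x of λ where
        (yes refl) → trans Ix≡c (cong (_∧ c) (sym (==-refl x)))
        (no v≢x)   → let (Tc , x∼v) = X-after-left v Xv v≢x ¬X′v in
          trans (to T-not-≡ (T-not⁺ λ Iv → independent m x v (subst T (sym Ix≡c) Tc) Iv x∼v))
                (cong (_∧ c) (sym (==-≢ v≢x)))

    Agrees-after : ∀ {J₀ I} → IsMIS (λ _ → true) I → Agrees J₀ X I → mem I x ≡ c →
      Agrees (J₀-after X J₀ x c) (X-after X x c) I
    Agrees-after m agr Ix≡c v ¬X′v = case T? (X v) of λ where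
      (no ¬Xv) → trans (agr v ¬Xv) (sym (if-false ¬Xv))
      (yes Xv) → trans (leaving m Ix≡c v Xv ¬X′v) (sym (if-true Xv))

  agreeing≤misCount : ∀ {X J₀} → Consistent X J₀ →
    count (λ I → T? (isMaximalIndependent G I) ×-dec agrees? J₀ X I) ≤ misCount X
  agreeing≤misCount {X} {J₀} cons = count-injective (restrict X)
    (λ {I} (mis , agr) → restrict-IsMIS (λ _ → tt) (maximalIndependent⇒IsMIS {I} mis) (closed {I} agr))
    (λ (_ , agr) (_ , agr′) → restrict-injective λ p ¬Xp → trans (agr p ¬Xp) (sym (agr′ p ¬Xp)))
    where
    closed : ∀ {I} → Agrees J₀ X I → ∀ u v → T (mem I u) → Adj u v → T (X v) → T (X u)
    closed agr u v Iu u∼v Xv = decidable-stable (T? (X u)) λ ¬Xu →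
      cons u v ¬Xu (subst T (agr u ¬Xu) Iu) u∼v Xv

  stopped⇒MaxDeg2 : ∀ {X} → T (stopped G X) → MaxDeg2 X
  stopped⇒MaxDeg2 {X} st {v} Xv with to T-∨ (all-allFin⁻ st v)
  ... | inj₁ ¬Xv = ⊥-elim (T-not⁻ ¬Xv Xv)
  ... | inj₂ d≤2 = ≤ᵇ⇒≤ _ 2 d≤2

  empty⇒MaxDeg2 : ∀ {X} → (∀ v → ¬ T (X v)) → MaxDeg2 X
  empty⇒MaxDeg2 empty {v} Xv = ⊥-elim (empty v Xv)

  t≤run : ∀ I k t X → t ≤ proj₁ (run G I k t X)
  t≤run I zero t X = ≤-refl
  t≤run I (suc k) t X with firstMax (deg G X) X
  ... | nothing = ≤-refl
  ... | just x with stopped G (nextX G I X x)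
  ...   | true  = n≤1+n t
  ...   | false = ≤-trans (n≤1+n t) (t≤run I k (suc t) (nextX G I X x))

  -- the right-hand side of run when firstMax picks x
  continue : Vec Bool n → ℕ → ℕ → VSet n → Fin n → ℕ × VSet n
  continue I k t X x =
    if stopped G (nextX G I X x) then (suc t , nextX G I X x) else run G I k (suc t) (nextX G I X x)

  run-halt : ∀ I k t X → firstMax (deg G X) X ≡ nothing → run G I (suc k) t X ≡ (t , X)
  run-halt I k t X eq rewrite eq = refl

  run-step : ∀ I k t X {x} → firstMax (deg G X) X ≡ just x → run G I (suc k) t X ≡ continue I k t X x
  run-step I k t X eq rewrite eq = refl

  t<continue : ∀ I k t X x → suc t ≤ proj₁ (continue I k t X x)
  t<continue I k t X x with stopped G (nextX G I X x)
  ... | true  = ≤-refl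
  ... | false = t≤run I k (suc t) (nextX G I X x)

  module _ (tmax : ℕ) {Good : VSet n → Set} (Good? : Decidable Good) (L : ℕ)
           (leaf : ∀ {X} → MaxDeg2 X → Good X → misCount X ≤ L) where

    Accepted : ℕ × VSet n → Set
    Accepted r = proj₁ r ≤ tmax × Good (proj₂ r)

    Outcome : ℕ → ℕ → VSet n → VSet n → Vec Bool n → Set
    Outcome k t X J₀ I = T (isMaximalIndependent G I) × Agrees J₀ X I × Accepted (run G I k t X)

    outcome? : ∀ k t X J₀ → Decidable (Outcome k t X J₀)
    outcome? k t X J₀ I = T? (isMaximalIndependent G I) ×-dec agrees? J₀ X I ×-dec
      (proj₁ (run G I k t X) ≤? tmax ×-dec Good? (proj₂ (run G I k t X)))

    halted : ∀ {X J₀ t} {P : Pred (Vec Bool n) 0ℓ} {P? : Decidable P} → MaxDeg2 X → Consistent X J₀ →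
      (∀ {I} → P I → T (isMaximalIndependent G I) × Agrees J₀ X I × Accepted (t , X)) → count P? ≤ L
    halted {X} Δ≤2 cons P⇒ = case Good? X of λ where
      (yes good) → ≤-trans (count-mono λ p → let (mis , agr , _) = P⇒ p in mis , agr)
                           (≤-trans (agreeing≤misCount cons) (leaf Δ≤2 good))
      (no bad)   → ≤-trans (≤-reflexive (count≡0 λ I p → bad (proj₂ (proj₂ (proj₂ (P⇒ p)))))) z≤n

    L≤2^*L : ∀ b → L ≤ 2 ^ b * L
    L≤2^*L b = m≤n*m L (2 ^ b) {{m^n≢0 2 b}}

    Bounded : ℕ → ℕ → ℕ → Set
    Bounded k t b = ∀ X J₀ → tmax ≤ t + b → Consistent X J₀ → ∣ X ∣ ≤ k →
      count (outcome? k t X J₀) ≤ 2 ^ b * L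

    module Step (k t : ℕ) (X J₀ : VSet n) (x : Fin n) (cons : Consistent X J₀) (|X|≤ : ∣ X ∣ ≤ suc k)
                (eq : firstMax (deg G X) X ≡ just x) where

      exhausted : tmax ≤ t → count (outcome? (suc k) t X J₀) ≡ 0
      exhausted tmax≤t = count≡0 λ I (_ , _ , t′≤tmax , _) → 1+n≰n (begin
        suc t                         ≤⟨ t<continue I k t X x ⟩
        proj₁ (continue I k t X x)    ≡⟨ cong proj₁ (run-step I k t X eq) ⟨
        proj₁ (run G I (suc k) t X)   ≤⟨ t′≤tmax ⟩
        tmax                          ≤⟨ tmax≤t ⟩
        t                             ∎)
        where open ≤-Reasoning

      module _ (c : Bool) where
        private
          X′ = X-after X x c

          cons′ : Consistent X′ (J₀-after X J₀ x c)
          cons′ = Consistent-after X x c cons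

          X′<X : ∣ X′ ∣ < ∣ X ∣
          X′<X = X-after-shrinks X x c (FirstMax.firstMax-just (deg G X) X eq)

          continues : ∀ {I} → Outcome (suc k) t X J₀ I × mem I x ≡ c → (r : Vec Bool n → ℕ × VSet n) →
            (∀ I → (if stopped G X′ then (suc t , X′) else run G I k (suc t) X′) ≡ r I) →
            T (isMaximalIndependent G I) × Agrees (J₀-after X J₀ x c) X′ I × Accepted (r I)
          continues {I} ((mis , agr , acc) , Ix≡c) r run≡r =
            mis , Agrees-after X x c (maximalIndependent⇒IsMIS {I} mis) agr Ix≡c ,
            subst Accepted (trans (run-step I k t X eq) (trans resumed (run≡r I))) acc
            where
            resumed : continue I k t X x ≡ (if stopped G X′ then (suc t , X′) else run G I k (suc t) X′)
            resumed = cong (λ Z → if stopped G Z then (suc t , Z) else run G I k (suc t) Z) (cong (X-after X x) Ix≡c)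

        branch : ∀ {b} → Bounded k (suc t) b → tmax ≤ suc t + b →
          ∀ {Q : Pred (Vec Bool n) 0ℓ} {Q? : Decidable Q} →
          (∀ {I} → Q I → Outcome (suc k) t X J₀ I × mem I x ≡ c) → count Q? ≤ 2 ^ b * L
        branch {b} IH budget Q⇒ = case T? (stopped G X′) of λ where
          (yes st) → ≤-trans
            (halted (stopped⇒MaxDeg2 st) cons′
              λ {I} q → continues {I} (Q⇒ q) (λ _ → suc t , X′) (λ _ → if-true st))
            (L≤2^*L b)
          (no ¬st) → ≤-trans
            (count-mono λ {I} q → continues {I} (Q⇒ q) (λ I → run G I k (suc t) X′) (λ _ → if-false ¬st))
            (IH X′ (J₀-after X J₀ x c) budget cons′ (≤-pred (≤-trans X′<X |X|≤)))

      split : ∀ {b} → Bounded k (suc t) b → tmax ≤ suc t + b → count (outcome? (suc k) t X J₀) ≤ 2 ^ suc b * L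
      split {b} IH budget = begin
        count P?                                                ≤⟨ count-split (member? x) ⟩
        count (P? ∩? member? x) + count (P? ∩? ∁? (member? x))  ≤⟨ +-mono-≤
          (branch true IH budget λ (o , Ix) → o , to T-≡ Ix)
          (branch false IH budget λ (o , ¬Ix) → o , to T-not-≡ (T-not⁺ ¬Ix)) ⟩
        2 ^ b * L + 2 ^ b * L                                   ≡⟨ cong (2 ^ b * L +_) (+-identityʳ (2 ^ b * L)) ⟨
        2 * (2 ^ b * L)                                         ≡⟨ *-assoc 2 (2 ^ b) L ⟨
        2 ^ suc b * L                                           ∎
        where
        open ≤-Reasoning
        P? = outcome? (suc k) t X J₀

    run-count : ∀ k t b → Bounded k t b
    run-count zero t b X J₀ _ cons |X|≤0 =
      ≤-trans (halted (empty⇒MaxDeg2 λ v Xv →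
                         1+n≰n (≤-trans (Vertices.length≤count ([] ∷ []) (Xv ∷ [])) |X|≤0))
                      cons (λ o → o))
              (L≤2^*L b)
    run-count (suc k) t b X J₀ budget cons |X|≤ = by-choice (firstMax (deg G X) X) refl b budget
      where
      by-choice : ∀ m → firstMax (deg G X) X ≡ m → ∀ b → tmax ≤ t + b →
        count (outcome? (suc k) t X J₀) ≤ 2 ^ b * L
      by-choice nothing  eq b _ = ≤-trans
        (halted (empty⇒MaxDeg2 (FirstMax.firstMax-nothing (deg G X) X eq)) cons
          λ {I} (mis , agr , acc) → mis , agr , subst Accepted (run-halt I k t X eq) acc)
        (L≤2^*L b)
      by-choice (just x) eq zero budget =
        ≤-trans (≤-reflexive (exhausted (≤-trans budget (≤-reflexive (+-identityʳ t))))) z≤n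
        where open Step k t X J₀ x cons |X|≤ eq
      by-choice (just x) eq (suc b) budget =
        split (run-count k (suc t) b) (≤-trans budget (≤-reflexive (+-suc t b)))
        where open Step k t X J₀ x cons |X|≤ eq

misBound² : ∀ r → misBound r ^ 2 ≤ 2 ^ (3 + r)
misBound² 0             = s≤s (s≤s (s≤s (s≤s z≤n)))
misBound² 1             = ≤-trans (n≤1+n 9) (≤-trans (n≤1+n 10) (m≤m+n 11 5))
misBound² (suc (suc r)) = begin
  (2 * misBound r) ^ 2  ≡⟨ lemma (misBound r) ⟩
  4 * misBound r ^ 2    ≤⟨ *-monoʳ-≤ 4 (misBound² r) ⟩
  4 * 2 ^ (3 + r)       ≡⟨ *-assoc 2 2 (2 ^ (3 + r)) ⟩
  2 ^ (5 + r)           ∎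
  where
  open ≤-Reasoning
  lemma : ∀ x → 2 * x * (2 * x * 1) ≡ 4 * (x * (x * 1))
  lemma = solve-∀

^-distribʳ-* : ∀ x y k → (x * y) ^ k ≡ x ^ k * y ^ k
^-distribʳ-* x y zero    = refl
^-distribʳ-* x y (suc k) = trans (cong (x * y *_) (^-distribʳ-* x y k)) (lemma x y (x ^ k) (y ^ k))
  where
  lemma : ∀ x y X Y → x * y * (X * Y) ≡ x * X * (y * Y)
  lemma = solve-∀

*<⇒≤/ : ∀ q {t m} .{{_ : NonZero q}} → q * t < m → t ≤ m / q
*<⇒≤/ q {t} {m} qt<m =
  subst (_≤ m / q) (m*n/n≡m t q) (/-monoˡ-≤ q (≤-trans (≤-reflexive (*-comm t q)) (<⇒≤ qt<m)))

-- The 9q in the exponent of 2 comes from misBound²; it is the o(1)·n term and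
-- is absorbed by 6dn as soon as n ≥ 2q.
final-arithmetic : ∀ q e a b d n {C tmax i R} → 1 ≤ d → 2 * q ≤ n →
  C ≤ 2 ^ tmax * (3 ^ i * misBound R) → tmax * q ≤ a * n → R * q ≤ b * n → 3 * q * i < e * n →
  C ^ (6 * q) ≤ 3 ^ (2 * e * n) * 2 ^ ((6 * a + 3 * b + 6 * d) * n)
final-arithmetic q e a b d n {C} {tmax} {i} {R} 1≤d 2q≤n C≤ tmax≤ R≤ i< = begin
  C ^ (6 * q)
    ≤⟨ ^-monoˡ-≤ (6 * q) C≤ ⟩
  (2 ^ tmax * (3 ^ i * misBound R)) ^ (6 * q)
    ≡⟨ trans (^-distribʳ-* _ _ (6 * q)) (cong ((2 ^ tmax) ^ (6 * q) *_) (^-distribʳ-* _ _ (6 * q))) ⟩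
  (2 ^ tmax) ^ (6 * q) * ((3 ^ i) ^ (6 * q) * misBound R ^ (6 * q))
    ≤⟨ *-mono-≤ two-part (*-mono-≤ three-part bound-part) ⟩
  2 ^ (6 * (a * n)) * (3 ^ (2 * e * n) * 2 ^ (3 * (b * n) + 9 * q))
    ≡⟨ rearrange (2 ^ (6 * (a * n))) (3 ^ (2 * e * n)) (2 ^ (3 * (b * n) + 9 * q)) ⟩
  3 ^ (2 * e * n) * (2 ^ (6 * (a * n)) * 2 ^ (3 * (b * n) + 9 * q))
    ≡⟨ cong (3 ^ (2 * e * n) *_) (^-distribˡ-+-* 2 (6 * (a * n)) _) ⟨
  3 ^ (2 * e * n) * 2 ^ (6 * (a * n) + (3 * (b * n) + 9 * q))
    ≤⟨ *-monoʳ-≤ (3 ^ (2 * e * n)) (^-monoʳ-≤ 2 exponent) ⟩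
  3 ^ (2 * e * n) * 2 ^ ((6 * a + 3 * b + 6 * d) * n) ∎
  where
  open ≤-Reasoning
  rearrange : ∀ x y z → x * (y * z) ≡ y * (x * z)
  rearrange = solve-∀
  two-part : (2 ^ tmax) ^ (6 * q) ≤ 2 ^ (6 * (a * n))
  two-part = begin
    (2 ^ tmax) ^ (6 * q)  ≡⟨ ^-*-assoc 2 tmax (6 * q) ⟩
    2 ^ (tmax * (6 * q))  ≡⟨ cong (2 ^_) (lemma tmax q) ⟩
    2 ^ (6 * (tmax * q))  ≤⟨ ^-monoʳ-≤ 2 (*-monoʳ-≤ 6 tmax≤) ⟩
    2 ^ (6 * (a * n))     ∎
    where
    lemma : ∀ t q → t * (6 * q) ≡ 6 * (t * q)
    lemma = solve-∀
  three-part : (3 ^ i) ^ (6 * q) ≤ 3 ^ (2 * e * n)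
  three-part = begin
    (3 ^ i) ^ (6 * q)     ≡⟨ ^-*-assoc 3 i (6 * q) ⟩
    3 ^ (i * (6 * q))     ≡⟨ cong (3 ^_) (lemma i q) ⟩
    3 ^ (2 * (3 * q * i)) ≤⟨ ^-monoʳ-≤ 3 (*-monoʳ-≤ 2 (<⇒≤ i<)) ⟩
    3 ^ (2 * (e * n))     ≡⟨ cong (3 ^_) (*-assoc 2 e n) ⟨
    3 ^ (2 * e * n)       ∎
    where
    lemma : ∀ i q → i * (6 * q) ≡ 2 * (3 * q * i)
    lemma = solve-∀
  bound-part : misBound R ^ (6 * q) ≤ 2 ^ (3 * (b * n) + 9 * q)
  bound-part = begin
    misBound R ^ (6 * q)          ≡⟨ cong (misBound R ^_) (*-assoc 2 3 q) ⟩
    misBound R ^ (2 * (3 * q))    ≡⟨ ^-*-assoc (misBound R) 2 (3 * q) ⟨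
    (misBound R ^ 2) ^ (3 * q)    ≤⟨ ^-monoˡ-≤ (3 * q) (misBound² R) ⟩
    (2 ^ (3 + R)) ^ (3 * q)       ≡⟨ ^-*-assoc 2 (3 + R) (3 * q) ⟩
    2 ^ ((3 + R) * (3 * q))       ≡⟨ cong (2 ^_) (lemma R q) ⟩
    2 ^ (3 * (R * q) + 9 * q)     ≤⟨ ^-monoʳ-≤ 2 (+-monoˡ-≤ (9 * q) (*-monoʳ-≤ 3 R≤)) ⟩
    2 ^ (3 * (b * n) + 9 * q)     ∎
    where
    lemma : ∀ R q → (3 + R) * (3 * q) ≡ 3 * (R * q) + 9 * q
    lemma = solve-∀
  exponent : 6 * (a * n) + (3 * (b * n) + 9 * q) ≤ (6 * a + 3 * b + 6 * d) * n
  exponent = begin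
    6 * (a * n) + (3 * (b * n) + 9 * q)      ≤⟨ +-monoʳ-≤ (6 * (a * n)) (+-monoʳ-≤ (3 * (b * n)) 9q≤6dn) ⟩
    6 * (a * n) + (3 * (b * n) + 6 * d * n)  ≡⟨ lemma a b d n ⟩
    (6 * a + 3 * b + 6 * d) * n              ∎
    where
    lemma : ∀ a b d n → 6 * (a * n) + (3 * (b * n) + 6 * d * n) ≡ (6 * a + 3 * b + 6 * d) * n
    lemma = solve-∀
    9q≤6dn : 9 * q ≤ 6 * d * n
    9q≤6dn = begin
      9 * q        ≤⟨ *-monoˡ-≤ q (m≤m+n 9 3) ⟩
      12 * q       ≡⟨ *-assoc 6 2 q ⟩
      6 * (2 * q)  ≤⟨ *-monoʳ-≤ 6 2q≤n ⟩
      6 * n        ≤⟨ *-monoˡ-≤ n (*-monoʳ-≤ 6 1≤d) ⟩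
      6 * d * n    ∎

countMIS-bound : ∀ {n} (G : Graph n) q a b .{{_ : NonZero q}} →
  countMIS G q a b ≤ 2 ^ (a * n / q) * (3 ^ itm G * misBound (b * n / q))
countMIS-bound {n} G q a b = begin
  countMIS G q a b
    ≤⟨ count-mono accepted ⟩
  count (outcome? tmax Good? L leaf n 0 everything nothing-chosen)
    ≤⟨ run-count tmax Good? L leaf n 0 tmax everything nothing-chosen ≤-refl (λ _ _ ¬T _ → ⊥-elim (¬T tt))
         (≤-trans (length-filter _ (allFin n)) (≤-reflexive (length-tabulate (λ v → v)))) ⟩
  2 ^ tmax * L ∎
  where
  open ≤-Reasoning
  open Neighbourhoods G
  open MaximalIndependentSets G
  open MaxDeg2Bound G
  open TriangleMatchings G
  open Process G
  open Counting (Vec Bool n)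

  tmax = a * n / q
  L = 3 ^ itm G * misBound (b * n / q)

  everything nothing-chosen : VSet n
  everything _     = true
  nothing-chosen _ = false

  Good : VSet n → Set
  Good X = q * ∣R∣ X < b * n

  Good? : Decidable Good
  Good? X = q * ∣R∣ X <? b * n

  leaf : ∀ {X} → MaxDeg2 X → Good X → misCount X ≤ L
  leaf {X} Δ≤2 good = begin
    misCount X                           ≤⟨ misCount-maxDeg2 (suc (∣VT∣ X)) ≤-refl Δ≤2 ⟩
    3 ^ (∣VT∣ X / 3) * misBound (∣R∣ X)   ≤⟨ *-mono-≤ (^-monoʳ-≤ 3 (∣VT∣/3≤itm Δ≤2))
                                                      (misBound-mono (*<⇒≤/ q good)) ⟩
    L                                    ∎

  accepted : ∀ {I} → T (isMaximalIndependent G I ∧ (q * tI G I <ᵇ a * n) ∧ (q * rI G I <ᵇ b * n)) →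
    Outcome tmax Good? L leaf n 0 everything nothing-chosen I
  accepted h =
    let (mis , h′) = to T-∧ h ; (t< , r<) = to T-∧ h′ in
    mis , (λ _ ¬T → ⊥-elim (¬T tt)) , *<⇒≤/ q (<ᵇ⇒< _ _ t<) , <ᵇ⇒< _ _ r<

lemma3p3 : (q e a b : ℕ) → 0 < q → 0 < e → a ≤ q → b ≤ q →
    (d : ℕ) → 0 < d →
    ∃ λ N → ( (n : ℕ) → N ≤ n → (G : Graph n) →
      3 * q * itm G < (q ∸ e) * n →
      countMIS G q a b ^ (6 * q) ≤ 3 ^ (2 * (q ∸ e) * n) * 2 ^ ((6 * a + 3 * b + 6 * d) * n))
lemma3p3 q e a b 0<q _ _ _ d 0<d = 2 * q , λ n 2q≤n G 3q·itm< →
  final-arithmetic q (q ∸ e) a b d n {tmax = a * n / q} {itm G} {b * n / q}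
    0<d 2q≤n (countMIS-bound G q a b) (m/n*n≤m (a * n) q) (m/n*n≤m (b * n) q) 3q·itm<
  where
  instance
    q≢0 : NonZero q
    q≢0 = >-nonZero 0<q
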